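{- Let $G_1=(V_1,E_1)$ and $G_2=(V_2,E_2)$ be finite simple graphs. Suppose $H_1$ is a path-intersecting subgraph of $G_1$, $H_2$ is a path-intersecting subgraph of $G_2$, and $\varphi\colon H_1\to H_2$ is a graph isomorphism. Let $G_1\bigoplus_{H_1}G_2$ be the subgraph sum of $G_1$ and $G_2$ along $H_1\cong H_2$. Then $$\chi\Big(G_1\bigoplus_{H_1}G_2,t\Big)=\frac{\chi(G_1,t)\,\chi(G_2,t)}{\chi(H_1,t)}.$$
   Context: All graphs are non-empty, finite, undirected and simple. The chromatic polynomial $\chi(G,t)$ of a graph $G$ is the polynomial such that for every integer $k\ge 0$, $\chi(G,k)$ is the number of proper colorings of $G$ with $k$ colors (adjacent vertices receive different colors). A subgraph $H=(V_H,E_H)$ of a graph $G$ is called path-intersecting if for every pair of vertices $v_i,v_j\in V_H$ that are non-adjacent in $H$, there is no path $P=(V_P,E_P)$ in $G$ between $v_i$ and $v_j$ such that $E_H\cap E_P=\emptyset$ and $V_H\cap V_P=\{v_i,v_j\}$. The subgraph sum $G_1\bigoplus_{H_1}G_2$ is the simple graph obtained from the disjoint union of $G_1$ and $G_2$ by identifying each vertex $v$ of $H_1$ with the vertex $\varphi(v)$ of $H_2$; its vertex set has cardinality $|V_1|+|V_2|-|V(H_2)|$ and its edge set is $E_1\cup E_2$ (with the edges of $H_1$ and $H_2$ identified via $\varphi$). -}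

module Defs where

open import Data.Nat using (ℕ; zero; suc; _*_; _<_)
open import Data.Fin using (Fin; zero; suc; _≟_)
open import Data.Fin.Properties using ()
open import Data.Bool using (Bool; true; false; _∧_; not; if_then_else_)
open import Data.List using (List; []; _∷_; _++_; [_]; map; concatMap; length; filter; allFin)
open import Data.Bool.ListAction using (all)
open import Data.List.Relation.Unary.All using (All)
open import Data.List.Relation.Unary.Unique.Propositional using (Unique)
open import Data.List.Relation.Unary.Linked using (Linked)
open import Data.Product using (Σ; ∃; _×_; _,_)
open import Data.Sum using (_⊎_)
open import Data.Empty using (⊥)
open import Relation.Nullary using (¬_)
open import Relation.Nullary.Decidable using (⌊_⌋)
open import Relation.Binary.PropositionalEquality using (_≡_; _≢_)
open import Function.Bundles using (_⇔_)
open import Function.Definitions using (Injective)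

record Graph (n : ℕ) : Set where
  field
    adj   : Fin n → Fin n → Bool
    sym   : ∀ x y → adj x y ≡ adj y x
    irrfl : ∀ x → adj x x ≡ false
open Graph public

Adj : ∀ {n} → Graph n → Fin n → Fin n → Set
Adj G x y = adj G x y ≡ true

-- Chromatic polynomial, evaluated at k ∈ ℕ: number of proper k-colourings.

colourings : (n k : ℕ) → List (Fin n → Fin k)
colourings zero    k = [ (λ ()) ]
colourings (suc n) k =
  concatMap (λ c → map (λ a → cons a c) (allFin k)) (colourings n k)
  where
  cons : Fin k → (Fin n → Fin k) → Fin (suc n) → Fin k
  cons a c zero    = a
  cons a c (suc i) = c i

proper? : ∀ {n k} → Graph n → (Fin n → Fin k) → Bool
proper? {n} G c =
  all (λ x → all (λ y → if adj G x y then not ⌊ c x ≟ c y ⌋ else true) (allFin n)) (allFin n)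

χ : ∀ {n} → Graph n → ℕ → ℕ
χ {n} G k = length (filter (λ c → proper? G c ≡? true) (colourings n k))
  where
  open import Data.Bool.Properties using () renaming (_≟_ to _≡?_)

record Subgraph {n : ℕ} (G : Graph n) : Set where
  field
    m     : ℕ
    H     : Graph m
    emb   : Fin m → Fin n
    emb-injective : Injective _≡_ _≡_ emb
    emb-edge      : ∀ a b → Adj H a b → Adj G (emb a) (emb b)
open Subgraph public

InV : ∀ {n} {G : Graph n} → Subgraph G → Fin n → Set
InV S u = ∃ λ a → emb S a ≡ u

InE : ∀ {n} {G : Graph n} → Subgraph G → Fin n → Fin n → Set
InE S u v = ∃ λ a → ∃ λ b → emb S a ≡ u × emb S b ≡ v × Adj (H S) a b

-- Paths in G from x to y: vertex sequence x ∷ mid ++ [ y ], pairwise distinct,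
-- consecutive vertices adjacent.  Its edges are the consecutive pairs.

pathVerts : ∀ {n} → Fin n → List (Fin n) → Fin n → List (Fin n)
pathVerts x mid y = x ∷ (mid ++ [ y ])

IsPath : ∀ {n} → Graph n → Fin n → List (Fin n) → Fin n → Set
IsPath G x mid y = Unique (pathVerts x mid y) × Linked (Adj G) (pathVerts x mid y)

PathIntersecting : ∀ {n} {G : Graph n} → Subgraph G → Set
PathIntersecting {n} {G} S =
  ∀ (i j : Fin (m S)) → i ≢ j → ¬ Adj (H S) i j →
  ∀ (mid : List (Fin n)) → IsPath G (emb S i) mid (emb S j) →
  -- E_H ∩ E_P = ∅
  Linked (λ u v → ¬ InE S u v) (pathVerts (emb S i) mid (emb S j)) →
  -- V_H ∩ V_P = {v_i, v_j}
  All (λ u → InV S u → (u ≡ emb S i) ⊎ (u ≡ emb S j)) (pathVerts (emb S i) mid (emb S j)) →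
  ⊥

record Iso {m₁ m₂ : ℕ} (H₁ : Graph m₁) (H₂ : Graph m₂) : Set where
  field
    to      : Fin m₁ → Fin m₂
    from    : Fin m₂ → Fin m₁
    to-from : ∀ b → to (from b) ≡ b
    from-to : ∀ a → from (to a) ≡ a
    adj-iff : ∀ a a' → Adj H₁ a a' ⇔ Adj H₂ (to a) (to a')
open Iso public

-- G is the subgraph sum G₁ ⊕_{H₁} G₂ (up to isomorphism, i.e. as the
-- pushout): G₁ and G₂ embed injectively into G, every vertex of G comes
-- from G₁ or G₂, ι₁ v = ι₂ w exactly when v ∈ V(H₁) and w = φ(v), and the
-- edge set of G is the image of E₁ ∪ E₂.

record IsSubgraphSum {n₁ n₂ n : ℕ} (G₁ : Graph n₁) (G₂ : Graph n₂)
    (S₁ : Subgraph G₁) (S₂ : Subgraph G₂) (φ : Iso (H S₁) (H S₂))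
    (G : Graph n) : Set where
  field
    ι₁ : Fin n₁ → Fin n
    ι₂ : Fin n₂ → Fin n
    ι₁-injective : Injective _≡_ _≡_ ι₁
    ι₂-injective : Injective _≡_ _≡_ ι₂
    covers : ∀ x → (∃ λ v → ι₁ v ≡ x) ⊎ (∃ λ w → ι₂ w ≡ x)
    glue : ∀ v w → (ι₁ v ≡ ι₂ w) ⇔ (∃ λ a → emb S₁ a ≡ v × emb S₂ (to φ a) ≡ w)
    edges : ∀ x y → Adj G x y ⇔
      ((∃ λ u → ∃ λ v → ι₁ u ≡ x × ι₁ v ≡ y × Adj G₁ u v) ⊎
       (∃ λ u → ∃ λ v → ι₂ u ≡ x × ι₂ v ≡ y × Adj G₂ u v))

{-# OPTIONS --safe #-}
-- Count proper colourings of a graph by their restriction c to the glued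
-- part H: χ(G, k) = Σ_c ext(c), where ext(c) is the number of proper
-- extensions of c.  Colourings of the subgraph sum are exactly compatible
-- pairs of colourings of G₁ and G₂, so χ(G, k) = Σ_c ext₁(c) · ext₂(c).
-- If H₂ is path-intersecting in G₂, ext₂ is 0 on improper c and constant on
-- proper c: the vertices of H₂ adjacent to a component of G₂ − V(H₂) form a
-- clique, so two proper colourings c, c′ of H₂ are injective there, and
-- permuting colours on that component so that c becomes c′ maps extensions
-- of c injectively to extensions of c′.  Hence χ(G) = ext₂ · χ(G₁) and
-- χ(G₂) = ext₂ · χ(H), which gives the identity.
module Submission where

open import Defs hiding (sym)
open import Data.Bool using (Bool; true; false; not; if_then_else_)
import Data.Bool.Properties as Bool
open import Data.Bool.ListAction using (all)
open import Data.Empty using (⊥-elim)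
open import Data.Fin using (Fin; zero; suc)
open import Data.Fin.Permutation using (Permutation′; _⟨$⟩ʳ_; _⟨$⟩ˡ_; inverseˡ; _∘ₚ_; transpose)
  renaming (id to idₚ)
open import Data.Fin.Properties using (_≟_; any?; all?; injective⇒≤)
open import Data.List using (List; []; _∷_; _++_; [_]; map; concatMap; length; filter; allFin; lookup)
open import Data.List.Properties using (map-tabulate; filter-≐)
open import Data.List.Membership.Propositional using (_∈_)
open import Data.List.Membership.Propositional.Properties using (∈-allFin; ∈-lookup; ∈-filter⁺; ∈-filter⁻)
open import Data.List.Relation.Unary.All as All using (All; []; _∷_)
import Data.List.Relation.Unary.All.Properties as All
open import Data.List.Relation.Unary.AllPairs using ([]; _∷_)
import Data.List.Relation.Unary.AllPairs.Properties as AllPairs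
import Data.List.Relation.Unary.Any as Any
open import Data.List.Relation.Unary.Any using (here; there)
open import Data.List.Relation.Unary.Linked using (Linked; [-]; _∷_)
open import Data.List.Relation.Unary.Unique.Propositional using (Unique)
open import Data.Nat using (ℕ; zero; suc; _+_; _*_; _≤_; _<_; z≤n; s≤s)
import Data.Nat.Properties as ℕ
open import Data.Product using (Σ; ∃; _×_; _,_; proj₁; proj₂)
open import Data.Product.Function.NonDependent.Propositional using (_×-⇔_)
open import Data.Sum using (_⊎_; inj₁; inj₂; [_,_]′)
open import Data.Vec.Functional as Vector using ()
open import Function using (_∘_; id)
open import Function.Bundles using (_⇔_; mk⇔; Equivalence)
open import Function.Definitions using (Injective)
open import Relation.Nullary using (Dec; yes; no; does; ¬_; ¬?; _×-dec_; contradiction)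
open import Relation.Nullary.Decidable using (⌊_⌋; map′; dec-true; dec-false; does-⇔; decidable-stable)
open import Relation.Unary using (Decidable)
open import Relation.Binary.PropositionalEquality
  using (_≡_; _≢_; refl; sym; trans; cong; cong₂; subst₂; _≗_; module ≡-Reasoning)

open import Algebra.Properties.CommutativeSemigroup ℕ.+-commutativeSemigroup
  using () renaming (interchange to +-interchange)
open import Algebra.Properties.CommutativeSemigroup ℕ.*-commutativeSemigroup
  using () renaming (interchange to *-interchange)

module ⇔ = Equivalence

private
  variable
    A B P Q : Set

-- Sums over lists and indicators

∑ : List A → (A → ℕ) → ℕ
∑ []       f = 0
∑ (x ∷ xs) f = f x + ∑ xs f

∑-cong : ∀ xs {f g : A → ℕ} → (∀ x → f x ≡ g x) → ∑ xs f ≡ ∑ xs g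
∑-cong []       _ = refl
∑-cong (x ∷ xs) f≗g = cong₂ _+_ (f≗g x) (∑-cong xs f≗g)

∑-zeroᴬ : ∀ {xs} {f : A → ℕ} → All (λ x → f x ≡ 0) xs → ∑ xs f ≡ 0
∑-zeroᴬ []            = refl
∑-zeroᴬ (fx≡0 ∷ rest) = cong₂ _+_ fx≡0 (∑-zeroᴬ rest)

∑-zero : ∀ xs {f : A → ℕ} → (∀ x → f x ≡ 0) → ∑ xs f ≡ 0
∑-zero xs f≗0 = ∑-zeroᴬ (All.universal f≗0 xs)

∑-mono : ∀ xs {f g : A → ℕ} → (∀ x → f x ≤ g x) → ∑ xs f ≤ ∑ xs g
∑-mono []       _    = z≤n
∑-mono (x ∷ xs) f≤g = ℕ.+-mono-≤ (f≤g x) (∑-mono xs f≤g)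

∑-+ : ∀ xs (f g : A → ℕ) → ∑ xs (λ x → f x + g x) ≡ ∑ xs f + ∑ xs g
∑-+ []       f g = refl
∑-+ (x ∷ xs) f g =
  trans (cong (f x + g x +_) (∑-+ xs f g)) (+-interchange (f x) (g x) (∑ xs f) (∑ xs g))

∑-*ˡ : ∀ xs m (f : A → ℕ) → ∑ xs (λ x → m * f x) ≡ m * ∑ xs f
∑-*ˡ []       m f = sym (ℕ.*-zeroʳ m)
∑-*ˡ (x ∷ xs) m f =
  trans (cong (m * f x +_) (∑-*ˡ xs m f)) (sym (ℕ.*-distribˡ-+ m (f x) (∑ xs f)))

∑-*ʳ : ∀ xs m (f : A → ℕ) → ∑ xs (λ x → f x * m) ≡ ∑ xs f * m
∑-*ʳ xs m f = trans (∑-cong xs (λ x → ℕ.*-comm (f x) m))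
                    (trans (∑-*ˡ xs m f) (ℕ.*-comm m (∑ xs f)))

∑-++ : ∀ xs ys (f : A → ℕ) → ∑ (xs ++ ys) f ≡ ∑ xs f + ∑ ys f
∑-++ []       ys f = refl
∑-++ (x ∷ xs) ys f = trans (cong (f x +_) (∑-++ xs ys f)) (sym (ℕ.+-assoc (f x) _ _))

∑-map : ∀ xs {h : A → B} {f : B → ℕ} → ∑ (map h xs) f ≡ ∑ xs (f ∘ h)
∑-map []       = refl
∑-map (x ∷ xs) = cong (_ +_) (∑-map xs)

∑-concatMap : ∀ xs {h : A → List B} {f : B → ℕ} →
              ∑ (concatMap h xs) f ≡ ∑ xs (λ x → ∑ (h x) f)
∑-concatMap []                 = refl
∑-concatMap (x ∷ xs) {h} {f} = trans (∑-++ (h x) _ f) (cong (_ +_) (∑-concatMap xs))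

∑-swap : ∀ xs ys (f : A → B → ℕ) →
         ∑ xs (λ x → ∑ ys (f x)) ≡ ∑ ys (λ y → ∑ xs (λ x → f x y))
∑-swap []       ys f = sym (∑-zero ys (λ _ → refl))
∑-swap (x ∷ xs) ys f = trans (cong (∑ ys (f x) +_) (∑-swap xs ys f)) (sym (∑-+ ys (f x) _))

∑-*-∑ : ∀ xs ys (f : A → ℕ) (g : B → ℕ) →
        ∑ xs f * ∑ ys g ≡ ∑ xs (λ x → ∑ ys (λ y → f x * g y))
∑-*-∑ xs ys f g = sym (trans (∑-cong xs (λ x → ∑-*ˡ ys (f x) g)) (∑-*ʳ xs (∑ ys g) f))

∑-allFin-suc : ∀ k (f : Fin (suc k) → ℕ) → ∑ (allFin (suc k)) f ≡ f zero + ∑ (allFin k) (f ∘ suc)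
∑-allFin-suc k f =
  cong (f zero +_) (trans (cong (λ xs → ∑ xs f) (sym (map-tabulate id suc))) (∑-map (allFin k)))

𝟙 : Dec P → ℕ
𝟙 P? = if does P? then 1 else 0

𝟙-yes : (P? : Dec P) → P → 𝟙 P? ≡ 1
𝟙-yes P? p = cong (λ b → if b then 1 else 0) (dec-true P? p)

𝟙-no : (P? : Dec P) → ¬ P → 𝟙 P? ≡ 0
𝟙-no P? ¬p = cong (λ b → if b then 1 else 0) (dec-false P? ¬p)

𝟙-⇔ : P ⇔ Q → (P? : Dec P) (Q? : Dec Q) → 𝟙 P? ≡ 𝟙 Q?
𝟙-⇔ P⇔Q P? Q? = cong (λ b → if b then 1 else 0) (does-⇔ P⇔Q P? Q?)

𝟙-× : (P? : Dec P) (Q? : Dec Q) → 𝟙 (P? ×-dec Q?) ≡ 𝟙 P? * 𝟙 Q?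
𝟙-× (yes _) (yes _) = refl
𝟙-× (yes _) (no _)  = refl
𝟙-× (no _)  _       = refl

𝟙-mono : (P → Q) → (P? : Dec P) (Q? : Dec Q) → 𝟙 P? ≤ 𝟙 Q?
𝟙-mono P⇒Q (yes p) Q? = ℕ.≤-reflexive (sym (𝟙-yes Q? (P⇒Q p)))
𝟙-mono P⇒Q (no _)  Q? = z≤n

𝟙-*-cong : (P? : Dec P) {x y : ℕ} → (P → x ≡ y) → 𝟙 P? * x ≡ 𝟙 P? * y
𝟙-*-cong (yes p) x≡y = cong (1 *_) (x≡y p)
𝟙-*-cong (no _)  _   = refl

length-filter≡∑𝟙 : ∀ {P : A → Set} (P? : Decidable P) xs →
                   length (filter P? xs) ≡ ∑ xs (𝟙 ∘ P?)
length-filter≡∑𝟙 P? []       = refl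
length-filter≡∑𝟙 P? (x ∷ xs) with does (P? x)
... | true  = cong suc (length-filter≡∑𝟙 P? xs)
... | false = length-filter≡∑𝟙 P? xs

∑-*-∑𝟙 : ∀ {P : A → Set} (P? : Decidable P) xs (f g : A → ℕ) →
         (∀ {x} → ¬ P x → f x ≡ 0) → (∀ {x} → ¬ P x → g x ≡ 0) →
         (∀ {x y} → P x → P y → g x ≡ g y) →
         ∑ xs (λ x → f x * g x) * ∑ xs (𝟙 ∘ P?) ≡ ∑ xs f * ∑ xs g
∑-*-∑𝟙 P? xs f g f-vanishes g-vanishes g-constant = begin
    ∑ xs (λ x → f x * g x) * ∑ xs (𝟙 ∘ P?)
  ≡⟨ ∑-*-∑ xs xs _ _ ⟩
    ∑ xs (λ x → ∑ xs (λ y → (f x * g x) * 𝟙 (P? y)))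
  ≡⟨ ∑-cong xs (λ x → ∑-cong xs (term x)) ⟩
    ∑ xs (λ x → ∑ xs (λ y → f x * g y))
  ≡⟨ ∑-*-∑ xs xs f g ⟨
    ∑ xs f * ∑ xs g ∎
  where
  open ≡-Reasoning
  term : ∀ x y → (f x * g x) * 𝟙 (P? y) ≡ f x * g y
  term x y with P? x | P? y
  ... | no ¬px | _      rewrite f-vanishes ¬px = refl
  ... | yes px | yes py = trans (ℕ.*-identityʳ _) (cong (f x *_) (g-constant px py))
  ... | yes px | no ¬py = trans (ℕ.*-zeroʳ (f x * g x))
                                (sym (trans (cong (f x *_) (g-vanishes ¬py)) (ℕ.*-zeroʳ (f x))))

Colouring : ℕ → ℕ → Set
Colouring n k = Fin n → Fin k

infix 4 _≗?_

_≗?_ : ∀ {n k} (c d : Colouring n k) → Dec (c ≗ d)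
c ≗? d = all? (λ i → c i ≟ d i)

∑-𝟙≟ : ∀ {k} (x : Fin k) → ∑ (allFin k) (λ a → 𝟙 (x ≟ a)) ≡ 1
∑-𝟙≟ {suc k} zero    =
  trans (∑-allFin-suc k (λ a → 𝟙 (zero ≟ a))) (cong suc (∑-zero (allFin k) (λ _ → refl)))
∑-𝟙≟ {suc k} (suc x) = trans (∑-allFin-suc k (λ a → 𝟙 (suc x ≟ a))) (∑-𝟙≟ x)

-- colourings extends by a local cons that agrees with Vector._∷_ only
-- pointwise, hence the hypothesis that f respects ≗.
∑-colourings-suc : ∀ n k (f : Colouring (suc n) k → ℕ) → (∀ {c d} → c ≗ d → f c ≡ f d) →
  ∑ (colourings (suc n) k) f ≡ ∑ (colourings n k) (λ c → ∑ (allFin k) (λ a → f (a Vector.∷ c)))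
∑-colourings-suc n k f f-resp = trans (∑-concatMap (colourings n k))
  (∑-cong (colourings n k) (λ c → trans (∑-map (allFin k))
    (∑-cong (allFin k) (λ a → f-resp λ { zero → refl ; (suc i) → refl }))))

∑-𝟙≗? : ∀ {n k} (f : Colouring n k) → ∑ (colourings n k) (λ c → 𝟙 (f ≗? c)) ≡ 1
∑-𝟙≗? {zero}      f = cong (_+ 0) (𝟙-yes (f ≗? λ ()) (λ ()))
∑-𝟙≗? {suc n} {k} f = begin
    ∑ (colourings (suc n) k) (λ c → 𝟙 (f ≗? c))
  ≡⟨ ∑-colourings-suc n k _ (λ {c} {d} c≗d → 𝟙-⇔ (≗-respʳ c≗d) (f ≗? c) (f ≗? d)) ⟩
    ∑ (colourings n k) (λ c → ∑ (allFin k) (λ a → 𝟙 (f ≗? (a Vector.∷ c))))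
  ≡⟨ ∑-cong (colourings n k) (λ c → ∑-cong (allFin k) (λ a →
       trans (𝟙-⇔ ≗-∷⇔ (f ≗? (a Vector.∷ c)) (f zero ≟ a ×-dec f ∘ suc ≗? c))
             (𝟙-× (f zero ≟ a) (f ∘ suc ≗? c)))) ⟩
    ∑ (colourings n k) (λ c → ∑ (allFin k) (λ a → 𝟙 (f zero ≟ a) * 𝟙 (f ∘ suc ≗? c)))
  ≡⟨ ∑-cong (colourings n k) (λ c →
       trans (∑-*ʳ (allFin k) (𝟙 (f ∘ suc ≗? c)) (λ a → 𝟙 (f zero ≟ a)))
             (trans (cong (_* 𝟙 (f ∘ suc ≗? c)) (∑-𝟙≟ (f zero))) (ℕ.*-identityˡ _))) ⟩
    ∑ (colourings n k) (λ c → 𝟙 (f ∘ suc ≗? c))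
  ≡⟨ ∑-𝟙≗? (f ∘ suc) ⟩
    1 ∎
  where
  open ≡-Reasoning
  ≗-respʳ : ∀ {c d} → c ≗ d → f ≗ c ⇔ f ≗ d
  ≗-respʳ c≗d = mk⇔ (λ f≗c i → trans (f≗c i) (c≗d i)) (λ f≗d i → trans (f≗d i) (sym (c≗d i)))
  ≗-∷⇔ : ∀ {a c} → f ≗ (a Vector.∷ c) ⇔ (f zero ≡ a × f ∘ suc ≗ c)
  ≗-∷⇔ = mk⇔ (λ f≗ → f≗ zero , f≗ ∘ suc)
             (λ { (eq , f≗) zero → eq ; (eq , f≗) (suc i) → f≗ i })

∑-fibres : ∀ {m k} xs (key : A → Colouring m k) (p : A → ℕ) →
           ∑ xs p ≡ ∑ (colourings m k) (λ c → ∑ xs (λ x → 𝟙 (key x ≗? c) * p x))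
∑-fibres {m = m} {k} xs key p = trans (∑-cong xs one-fibre) (∑-swap xs (colourings m k) _)
  where
  one-fibre : ∀ x → p x ≡ ∑ (colourings m k) (λ c → 𝟙 (key x ≗? c) * p x)
  one-fibre x = sym (trans (∑-*ʳ (colourings m k) (p x) _)
                    (trans (cong (_* p x) (∑-𝟙≗? (key x))) (ℕ.*-identityˡ (p x))))

∑-𝟙≗?-𝟙≗? : ∀ {m k} (a b : Colouring m k) →
             ∑ (colourings m k) (λ c → 𝟙 (a ≗? c) * 𝟙 (b ≗? c)) ≡ 𝟙 (a ≗? b)
∑-𝟙≗?-𝟙≗? {m} {k} a b = begin
    ∑ Cs (λ c → 𝟙 (a ≗? c) * 𝟙 (b ≗? c))
  ≡⟨ ∑-cong Cs (λ c → 𝟙-*-cong (a ≗? c) (λ a≗c → 𝟙-⇔ (b≗⇔ a≗c) (b ≗? c) (a ≗? b))) ⟩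
    ∑ Cs (λ c → 𝟙 (a ≗? c) * 𝟙 (a ≗? b))
  ≡⟨ ∑-*ʳ Cs (𝟙 (a ≗? b)) (λ c → 𝟙 (a ≗? c)) ⟩
    ∑ Cs (λ c → 𝟙 (a ≗? c)) * 𝟙 (a ≗? b)
  ≡⟨ cong (_* 𝟙 (a ≗? b)) (∑-𝟙≗? a) ⟩
    1 * 𝟙 (a ≗? b)
  ≡⟨ ℕ.*-identityˡ _ ⟩
    𝟙 (a ≗? b) ∎
  where
  open ≡-Reasoning
  Cs = colourings m k
  b≗⇔ : ∀ {c} → a ≗ c → b ≗ c ⇔ a ≗ b
  b≗⇔ a≗c = mk⇔ (λ b≗c i → trans (a≗c i) (sym (b≗c i)))
                (λ a≗b i → trans (sym (a≗b i)) (a≗c i))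

∑𝟙-≤-injection : ∀ {n n′ k k′} {P : Colouring n k → Set} {Q : Colouring n′ k′ → Set}
  (P? : Decidable P) (Q? : Decidable Q) (F : Colouring n k → Colouring n′ k′) →
  (∀ {e e′} → e ≗ e′ → Q e → Q e′) →
  (∀ {d} → P d → Q (F d)) →
  (∀ {d d′} → P d → P d′ → F d ≗ F d′ → d ≗ d′) →
  ∑ (colourings n k) (𝟙 ∘ P?) ≤ ∑ (colourings n′ k′) (𝟙 ∘ Q?)
∑𝟙-≤-injection {n} {n′} {k} {k′} P? Q? F Q-resp P⇒QF F-injective = begin
    ∑ Cs (𝟙 ∘ P?)
  ≡⟨ ∑-fibres Cs F (𝟙 ∘ P?) ⟩
    ∑ Cs′ (λ e → ∑ Cs (λ d → 𝟙 (F d ≗? e) * 𝟙 (P? d)))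
  ≤⟨ ∑-mono Cs′ fibre≤ ⟩
    ∑ Cs′ (𝟙 ∘ Q?) ∎
  where
  open ℕ.≤-Reasoning
  Cs = colourings n k
  Cs′ = colourings n′ k′
  fibre≤ : ∀ e → ∑ Cs (λ d → 𝟙 (F d ≗? e) * 𝟙 (P? d)) ≤ 𝟙 (Q? e)
  fibre≤ e with Any.any? (λ d → F d ≗? e ×-dec P? d) Cs
  ... | no empty = ℕ.≤-trans (ℕ.≤-reflexive (∑-zeroᴬ (All.map
          (λ {d} ∉fibre → trans (sym (𝟙-× (F d ≗? e) (P? d))) (𝟙-no (F d ≗? e ×-dec P? d) ∉fibre))
          (All.¬Any⇒All¬ Cs empty)))) z≤n
  ... | yes inhabited with Any.satisfied inhabited
  ...   | d₀ , F[d₀]≗e , Pd₀ = begin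
      ∑ Cs (λ d → 𝟙 (F d ≗? e) * 𝟙 (P? d))
    ≤⟨ ∑-mono Cs (λ d → ℕ.≤-trans (ℕ.≤-reflexive (sym (𝟙-× (F d ≗? e) (P? d))))
         (𝟙-mono (λ (F[d]≗e , Pd) → F-injective Pd₀ Pd (λ x → trans (F[d₀]≗e x) (sym (F[d]≗e x))))
                 (F d ≗? e ×-dec P? d) (d₀ ≗? d))) ⟩
      ∑ Cs (λ d → 𝟙 (d₀ ≗? d))
    ≡⟨ ∑-𝟙≗? d₀ ⟩
      1
    ≡⟨ sym (𝟙-yes (Q? e) (Q-resp F[d₀]≗e (P⇒QF Pd₀))) ⟩
      𝟙 (Q? e) ∎

lookup-injective : ∀ {xs : List A} → Unique xs → Injective _≡_ _≡_ (lookup xs)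
lookup-injective {xs = x ∷ xs} (x∉xs ∷ _) {zero}  {zero}  _  = refl
lookup-injective {xs = x ∷ xs} (x∉xs ∷ _) {zero}  {suc j} eq = ⊥-elim (All.lookup x∉xs (∈-lookup j) eq)
lookup-injective {xs = x ∷ xs} (x∉xs ∷ _) {suc i} {zero}  eq =
  ⊥-elim (All.lookup x∉xs (∈-lookup i) (sym eq))
lookup-injective {xs = x ∷ xs} (_ ∷ unique) {suc i} {suc j} eq = cong suc (lookup-injective unique eq)

Unique⇒length≤ : ∀ {n} {xs : List (Fin n)} → Unique xs → length xs ≤ n
Unique⇒length≤ unique = injective⇒≤ (lookup-injective unique)

-- Colour permutations

InjectiveOn : (A → B) → List A → Set
InjectiveOn f as = ∀ {a b} → a ∈ as → b ∈ as → f a ≡ f b → a ≡ b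

⟨$⟩ʳ-injective : ∀ {k} (π : Permutation′ k) → Injective _≡_ _≡_ (π ⟨$⟩ʳ_)
⟨$⟩ʳ-injective π eq = trans (sym (inverseˡ π)) (trans (cong (π ⟨$⟩ˡ_) eq) (inverseˡ π))

transpose-sends : ∀ {k} (i j : Fin k) → transpose i j ⟨$⟩ʳ i ≡ j
transpose-sends i j rewrite dec-true (i ≟ i) refl = refl

transpose-fixes : ∀ {k} {i j x : Fin k} → x ≢ i → x ≢ j → transpose i j ⟨$⟩ʳ x ≡ x
transpose-fixes {i = i} {j} {x} x≢i x≢j rewrite dec-false (x ≟ i) x≢i | dec-false (x ≟ j) x≢j = refl

recolouring : ∀ {m k} (c c′ : Fin m → Fin k) → List (Fin m) → Permutation′ k
recolouring c c′ []       = idₚ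
recolouring c c′ (a ∷ as) = π ∘ₚ transpose (π ⟨$⟩ʳ c a) (c′ a)
  where π = recolouring c c′ as

recolouring-sends : ∀ {m k} {c c′ : Fin m → Fin k} {as} → InjectiveOn c as → InjectiveOn c′ as →
                    ∀ {a} → a ∈ as → recolouring c c′ as ⟨$⟩ʳ c a ≡ c′ a
recolouring-sends {c = c} {c′} {b ∷ as} c-inj c′-inj (here refl) =
  transpose-sends (recolouring c c′ as ⟨$⟩ʳ c b) (c′ b)
recolouring-sends {c = c} {c′} {b ∷ as} c-inj c′-inj {a} (there a∈as) with a ≟ b
... | yes refl = transpose-sends (recolouring c c′ as ⟨$⟩ʳ c a) (c′ a)
... | no a≢b   = trans (cong (transpose _ _ ⟨$⟩ʳ_) sends-a) (transpose-fixes ≢π[cb] ≢c′b)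
  where
  π = recolouring c c′ as
  sends-a : π ⟨$⟩ʳ c a ≡ c′ a
  sends-a = recolouring-sends (λ p q → c-inj (there p) (there q)) (λ p q → c′-inj (there p) (there q)) a∈as
  ≢π[cb] : c′ a ≢ π ⟨$⟩ʳ c b
  ≢π[cb] eq = a≢b (c-inj (there a∈as) (here refl) (⟨$⟩ʳ-injective π (trans sends-a eq)))
  ≢c′b : c′ a ≢ c′ b
  ≢c′b = a≢b ∘ c′-inj (there a∈as) (here refl)

Adj? : ∀ {n} (G : Graph n) x y → Dec (Adj G x y)
Adj? G x y = adj G x y Bool.≟ true

Adj-sym : ∀ {n} (G : Graph n) {x y} → Adj G x y → Adj G y x
Adj-sym G {x} {y} = trans (Graph.sym G y x)

Adj-irrefl : ∀ {n} (G : Graph n) {x y} → Adj G x y → x ≢ y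
Adj-irrefl G {x} xy refl with () ← trans (sym (irrfl G x)) xy

IsHomomorphism : ∀ {m n} → Graph m → Graph n → (Fin m → Fin n) → Set
IsHomomorphism H′ G e = ∀ a b → Adj H′ a b → Adj G (e a) (e b)

module _ {m₁ m₂} {H₁ : Graph m₁} {H₂ : Graph m₂} (φ : Iso H₁ H₂) where

  Iso-to-homomorphism : IsHomomorphism H₁ H₂ (to φ)
  Iso-to-homomorphism a b = ⇔.to (adj-iff φ a b)

  Iso-from-homomorphism : IsHomomorphism H₂ H₁ (from φ)
  Iso-from-homomorphism x y xy = ⇔.from (adj-iff φ (from φ x) (from φ y))
    (subst₂ (Adj H₂) (sym (to-from φ x)) (sym (to-from φ y)) xy)

Proper : ∀ {n k} → Graph n → Colouring n k → Set
Proper G c = ∀ x y → Adj G x y → c x ≢ c y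

all≡true⇔All : (p : A → Bool) (xs : List A) → all p xs ≡ true ⇔ All (λ x → p x ≡ true) xs
all≡true⇔All p []       = mk⇔ (λ _ → []) (λ _ → refl)
all≡true⇔All p (x ∷ xs) with p x in px
... | true  = mk⇔ (λ h → px ∷ ⇔.to (all≡true⇔All p xs) h)
                  (λ { (_ ∷ h) → ⇔.from (all≡true⇔All p xs) h })
... | false = mk⇔ (λ ()) λ { (px≡true ∷ _) → contradiction (trans (sym px) px≡true) λ () }

all-allFin≡true⇔ : ∀ {n} (p : Fin n → Bool) → all p (allFin n) ≡ true ⇔ (∀ i → p i ≡ true)
all-allFin≡true⇔ {n} p = mk⇔
  (λ h i → All.lookup (⇔.to (all≡true⇔All p (allFin n)) h) (∈-allFin i))
  (λ h → ⇔.from (all≡true⇔All p (allFin n)) (All.universal h (allFin n)))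

if-not≡true⇔ : ∀ b (P? : Dec P) → (if b then not ⌊ P? ⌋ else true) ≡ true ⇔ (b ≡ true → ¬ P)
if-not≡true⇔ true  (yes p) = mk⇔ (λ ()) (λ h → ⊥-elim (h refl p))
if-not≡true⇔ true  (no ¬p) = mk⇔ (λ _ _ → ¬p) (λ _ → refl)
if-not≡true⇔ false _       = mk⇔ (λ _ ()) (λ _ → refl)

proper?⇔Proper : ∀ {n k} (G : Graph n) (c : Colouring n k) → proper? G c ≡ true ⇔ Proper G c
proper?⇔Proper G c = mk⇔
  (λ h x y → ⇔.to (clause x y) (⇔.to (row x) (⇔.to outer h x) y))
  (λ h → ⇔.from outer (λ x → ⇔.from (row x) (λ y → ⇔.from (clause x y) (h x y))))
  where
  clause = λ x y → if-not≡true⇔ (adj G x y) (c x ≟ c y)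
  row = λ x → all-allFin≡true⇔ (λ y → if adj G x y then not ⌊ c x ≟ c y ⌋ else true)
  outer = all-allFin≡true⇔ _

-- Decided through proper?, so that χ≡∑𝟙Proper holds by computation.
Proper? : ∀ {n k} (G : Graph n) → Decidable (Proper {k = k} G)
Proper? G c = map′ (⇔.to (proper?⇔Proper G c)) (⇔.from (proper?⇔Proper G c)) (proper? G c Bool.≟ true)

χ≡∑𝟙Proper : ∀ {n} (G : Graph n) k → χ G k ≡ ∑ (colourings n k) (𝟙 ∘ Proper? G)
χ≡∑𝟙Proper {n} G k = length-filter≡∑𝟙 _ (colourings n k)

Proper-resp : ∀ {n k} (G : Graph n) {c d : Colouring n k} → c ≗ d → Proper G c → Proper G d
Proper-resp G c≗d proper x y xy dx≡dy = proper x y xy (trans (c≗d x) (trans dx≡dy (sym (c≗d y))))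

Proper-∘ : ∀ {m n k} {H′ : Graph m} {G : Graph n} {e : Fin m → Fin n} {d : Colouring n k} →
           IsHomomorphism H′ G e → Proper G d → Proper H′ (d ∘ e)
Proper-∘ {e = e} e-hom proper a b ab = proper (e a) (e b) (e-hom a b ab)

ProperExtension : ∀ {m n k} → Graph n → (Fin m → Fin n) → Colouring m k → Colouring n k → Set
ProperExtension G e c d = d ∘ e ≗ c × Proper G d

properExtension? : ∀ {m n k} (G : Graph n) (e : Fin m → Fin n) (c : Colouring m k) →
                   Decidable (ProperExtension G e c)
properExtension? G e c d = d ∘ e ≗? c ×-dec Proper? G d

ProperExtension-resp : ∀ {m n k} (G : Graph n) (e : Fin m → Fin n) (c : Colouring m k) {d d′} →
                       d ≗ d′ → ProperExtension G e c d → ProperExtension G e c d′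
ProperExtension-resp G e c d≗d′ (d∘e≗c , proper) =
  (λ a → trans (sym (d≗d′ (e a))) (d∘e≗c a)) , Proper-resp G d≗d′ proper

extensions : ∀ {m n k} → Graph n → (Fin m → Fin n) → Colouring m k → ℕ
extensions {n = n} {k} G e c = ∑ (colourings n k) (𝟙 ∘ properExtension? G e c)

χ≡∑extensions : ∀ {m n} (G : Graph n) (e : Fin m → Fin n) k →
                χ G k ≡ ∑ (colourings m k) (extensions G e)
χ≡∑extensions {m} {n} G e k = begin
    χ G k
  ≡⟨ χ≡∑𝟙Proper G k ⟩
    ∑ (colourings n k) (𝟙 ∘ Proper? G)
  ≡⟨ ∑-fibres (colourings n k) (_∘ e) (𝟙 ∘ Proper? G) ⟩
    ∑ (colourings m k) (λ c → ∑ (colourings n k) (λ d → 𝟙 (d ∘ e ≗? c) * 𝟙 (Proper? G d)))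
  ≡⟨ ∑-cong (colourings m k) (λ c → ∑-cong (colourings n k) (λ d →
       sym (𝟙-× (d ∘ e ≗? c) (Proper? G d)))) ⟩
    ∑ (colourings m k) (extensions G e) ∎
  where open ≡-Reasoning

extensions-∘ : ∀ {m m′ n k} (G : Graph n) (e : Fin m → Fin n)
               {f : Fin m′ → Fin m} {g : Fin m → Fin m′} →
               (∀ a → f (g a) ≡ a) → (∀ a′ → g (f a′) ≡ a′) →
               (c : Colouring m′ k) → extensions G (e ∘ f) c ≡ extensions G e (c ∘ g)
extensions-∘ {n = n} {k} G e {f} {g} fg gf c = ∑-cong (colourings n k) (λ d →
  𝟙-⇔ (restricts⇔ d ×-⇔ mk⇔ id id) (properExtension? G (e ∘ f) c d) (properExtension? G e (c ∘ g) d))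
  where
  restricts⇔ : ∀ d → d ∘ e ∘ f ≗ c ⇔ d ∘ e ≗ c ∘ g
  restricts⇔ d = mk⇔ (λ h a → trans (cong (d ∘ e) (sym (fg a))) (h (g a)))
                     (λ h a′ → trans (h (f a′)) (cong c (gf a′)))

extensions-of-improper : ∀ {m n k} {H′ : Graph m} (G : Graph n) {e : Fin m → Fin n} →
                         IsHomomorphism H′ G e → {c : Colouring m k} → ¬ Proper H′ c →
                         extensions G e c ≡ 0
extensions-of-improper {n = n} {k} {H′} G {e} e-hom {c} ¬proper =
  ∑-zero (colourings n k) (λ d → 𝟙-no (properExtension? G e c d) (improper d))
  where
  improper : ∀ d → ¬ ProperExtension G e c d
  improper d (d∘e≗c , proper) =
    ¬proper (Proper-resp H′ {d ∘ e} d∘e≗c (Proper-∘ {H′ = H′} {G = G} e-hom proper))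

∑-extensions-* : ∀ {m n₁ n₂} (G₁ : Graph n₁) (G₂ : Graph n₂)
                 (e₁ : Fin m → Fin n₁) (e₂ : Fin m → Fin n₂) k →
  ∑ (colourings m k) (λ c → extensions G₁ e₁ c * extensions G₂ e₂ c)
    ≡ ∑ (colourings n₁ k) (λ d₁ → ∑ (colourings n₂ k) (λ d₂ →
        𝟙 (d₁ ∘ e₁ ≗? d₂ ∘ e₂) * (𝟙 (Proper? G₁ d₁) * 𝟙 (Proper? G₂ d₂))))
∑-extensions-* {m} {n₁} {n₂} G₁ G₂ e₁ e₂ k = begin
    ∑ Cs (λ c → extensions G₁ e₁ c * extensions G₂ e₂ c)
  ≡⟨ ∑-cong Cs (λ c → ∑-*-∑ C₁ C₂ _ _) ⟩
    ∑ Cs (λ c → ∑ C₁ (λ d₁ → ∑ C₂ (λ d₂ → E₁ d₁ c * E₂ d₂ c)))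
  ≡⟨ ∑-swap Cs C₁ _ ⟩
    ∑ C₁ (λ d₁ → ∑ Cs (λ c → ∑ C₂ (λ d₂ → E₁ d₁ c * E₂ d₂ c)))
  ≡⟨ ∑-cong C₁ (λ d₁ → ∑-swap Cs C₂ _) ⟩
    ∑ C₁ (λ d₁ → ∑ C₂ (λ d₂ → ∑ Cs (λ c → E₁ d₁ c * E₂ d₂ c)))
  ≡⟨ ∑-cong C₁ (λ d₁ → ∑-cong C₂ (λ d₂ → glue d₁ d₂)) ⟩
    ∑ C₁ (λ d₁ → ∑ C₂ (λ d₂ →
      𝟙 (d₁ ∘ e₁ ≗? d₂ ∘ e₂) * (𝟙 (Proper? G₁ d₁) * 𝟙 (Proper? G₂ d₂)))) ∎
  where
  open ≡-Reasoning
  Cs = colourings m k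
  C₁ = colourings n₁ k
  C₂ = colourings n₂ k
  E₁ = λ d₁ c → 𝟙 (properExtension? G₁ e₁ c d₁)
  E₂ = λ d₂ c → 𝟙 (properExtension? G₂ e₂ c d₂)
  glue : ∀ d₁ d₂ → ∑ Cs (λ c → E₁ d₁ c * E₂ d₂ c)
                   ≡ 𝟙 (d₁ ∘ e₁ ≗? d₂ ∘ e₂) * (𝟙 (Proper? G₁ d₁) * 𝟙 (Proper? G₂ d₂))
  glue d₁ d₂ = begin
      ∑ Cs (λ c → E₁ d₁ c * E₂ d₂ c)
    ≡⟨ ∑-cong Cs (λ c →
         trans (cong₂ _*_ (𝟙-× (d₁ ∘ e₁ ≗? c) P₁) (𝟙-× (d₂ ∘ e₂ ≗? c) P₂))
               (*-interchange (𝟙 (d₁ ∘ e₁ ≗? c)) (𝟙 P₁) (𝟙 (d₂ ∘ e₂ ≗? c)) (𝟙 P₂))) ⟩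
      ∑ Cs (λ c → (𝟙 (d₁ ∘ e₁ ≗? c) * 𝟙 (d₂ ∘ e₂ ≗? c)) * (𝟙 P₁ * 𝟙 P₂))
    ≡⟨ ∑-*ʳ Cs (𝟙 P₁ * 𝟙 P₂) _ ⟩
      ∑ Cs (λ c → 𝟙 (d₁ ∘ e₁ ≗? c) * 𝟙 (d₂ ∘ e₂ ≗? c)) * (𝟙 P₁ * 𝟙 P₂)
    ≡⟨ cong (_* (𝟙 P₁ * 𝟙 P₂)) (∑-𝟙≗?-𝟙≗? (d₁ ∘ e₁) (d₂ ∘ e₂)) ⟩
      𝟙 (d₁ ∘ e₁ ≗? d₂ ∘ e₂) * (𝟙 P₁ * 𝟙 P₂) ∎
    where
    P₁ = Proper? G₁ d₁
    P₂ = Proper? G₂ d₂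

-- Path-intersecting subgraphs

module Walks {n} (G : Graph n) {O : Fin n → Set} (O? : Decidable O) where

  data Walk : Fin n → Fin n → Set where
    stay : ∀ {x} → O x → Walk x x
    step : ∀ {x y z} → O x → Adj G x y → Walk y z → Walk x z

  verts : ∀ {x z} → Walk x z → List (Fin n)
  verts (stay {x} _)     = [ x ]
  verts (step {x} _ _ w) = x ∷ verts w

  verts-inside : ∀ {x z} (w : Walk x z) → All O (verts w)
  verts-inside (stay o)     = o ∷ []
  verts-inside (step o _ w) = o ∷ verts-inside w

  first-inside : ∀ {x z} → Walk x z → O x
  first-inside (stay o)     = o
  first-inside (step o _ _) = o

  snoc : ∀ {x y z} → Walk x y → Adj G y z → O z → Walk x z
  snoc (stay o)      yz oz = step o yz (stay oz)
  snoc (step o xy w) yz oz = step o xy (snoc w yz oz)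

  reverseʷ : ∀ {x z} → Walk x z → Walk z x
  reverseʷ (stay o)      = stay o
  reverseʷ (step o xy w) = snoc (reverseʷ w) (Adj-sym G xy) o

  _++ʷ_ : ∀ {x y z} → Walk x y → Walk y z → Walk x z
  stay _      ++ʷ w′ = w′
  step o xy w ++ʷ w′ = step o xy (w ++ʷ w′)

  suffixFrom : ∀ {x y z} (w : Walk y z) → Unique (verts w) → x ∈ verts w → Σ (Walk x z) (Unique ∘ verts)
  suffixFrom (stay o)     unique       (here refl) = stay o , unique
  suffixFrom (step o a w) unique       (here refl) = step o a w , unique
  suffixFrom (step o a w) (_ ∷ unique) (there x∈w) = suffixFrom w unique x∈w

  shorten : ∀ {x z} → Walk x z → Σ (Walk x z) (Unique ∘ verts)
  shorten (stay o) = stay o , [] ∷ []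
  shorten (step {x} o xy w) with shorten w
  ... | w′ , unique with Any.any? (x ≟_) (verts w′)
  ...   | yes x∈w′ = suffixFrom w′ unique x∈w′
  ...   | no x∉w′  = step o xy w′ , All.¬Any⇒All¬ (verts w′) x∉w′ ∷ unique

  BoundedWalk : ℕ → Fin n → Fin n → Set
  BoundedWalk t x z = Σ (Walk x z) (λ w → length (verts w) ≤ t)

  unstep : ∀ {t x z} → BoundedWalk (suc t) x z → x ≡ z ⊎ ∃ λ y → Adj G x y × BoundedWalk t y z
  unstep (stay _ , _)              = inj₁ refl
  unstep (step _ xy w , s≤s len≤t) = inj₂ (_ , xy , w , len≤t)

  boundedWalk? : ∀ t x z → Dec (BoundedWalk t x z)
  boundedWalk? zero    x z = no λ { (stay _ , ()) ; (step _ _ _ , ()) }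
  boundedWalk? (suc t) x z with O? x | x ≟ z | any? (λ y → Adj? G x y ×-dec boundedWalk? t y z)
  ... | no ¬o | _        | _                        = no (¬o ∘ first-inside ∘ proj₁)
  ... | yes o | yes refl | _                        = yes (stay o , s≤s z≤n)
  ... | yes o | no _     | yes (_ , xy , w , len≤t) = yes (step o xy w , s≤s len≤t)
  ... | yes o | no x≢z   | no ¬next                 = no ([ x≢z , ¬next ]′ ∘ unstep)

  walk? : ∀ x z → Dec (Walk x z)
  walk? x z = map′ proj₁ bound (boundedWalk? n x z)
    where
    bound : Walk x z → BoundedWalk n x z
    bound w = let w′ , unique = shorten w in w′ , Unique⇒length≤ unique

  linked-verts : ∀ {x y z t} → Adj G x y → (w : Walk y z) → Adj G z t →
                 Linked (Adj G) (x ∷ verts w ++ [ t ])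
  linked-verts xy (stay _)       zt = xy ∷ zt ∷ [-]
  linked-verts xy (step _ yy′ w) zt = xy ∷ linked-verts yy′ w zt

module _ {n} {G : Graph n} (S : Subgraph G) where

  Outside : Fin n → Set
  Outside x = ¬ InV S x

  InV? : Decidable (InV S)
  InV? x = any? (λ a → emb S a ≟ x)

  ¬InE-along : ∀ {x y} mid → All Outside mid → ¬ InE S x y →
               Linked (λ u v → ¬ InE S u v) (x ∷ mid ++ [ y ])
  ¬InE-along []        []           ¬xy = ¬xy ∷ [-]
  ¬InE-along (u ∷ mid) (u-out ∷ outs) _ =
    (λ (_ , b , _ , eb≡u , _) → u-out (b , eb≡u))
    ∷ ¬InE-along mid outs (λ (a , _ , ea≡u , _) → u-out (a , ea≡u))

module Attachments {n} {G : Graph n} {S : Subgraph G} (S-pi : PathIntersecting S) where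

  open Walks G (¬? ∘ InV? S)

  Adj-of-outside-path : ∀ {a b} → a ≢ b → (mid : List (Fin n)) → All (Outside S) mid → Unique mid →
                        Linked (Adj G) (emb S a ∷ mid ++ [ emb S b ]) → Adj (H S) a b
  Adj-of-outside-path {a} {b} a≢b mid outs unique linked =
    decidable-stable (Adj? (H S) a b) λ ¬ab →
      S-pi a b a≢b ¬ab mid (distinct , linked) (¬InE-along S mid outs (¬InE ¬ab)) meets-H-at-ends
    where
    distinct : Unique (emb S a ∷ mid ++ [ emb S b ])
    distinct = All.++⁺ (All.map (λ out ea≡x → out (a , ea≡x)) outs) ((a≢b ∘ emb-injective S) ∷ [])
             ∷ AllPairs.++⁺ unique ([] ∷ [])
                 (All.map (λ out → (λ x≡eb → out (b , sym x≡eb)) ∷ []) outs)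
    ¬InE : ¬ Adj (H S) a b → ¬ InE S (emb S a) (emb S b)
    ¬InE ¬ab (a′ , b′ , ea′≡ea , eb′≡eb , a′b′) =
      ¬ab (subst₂ (Adj (H S)) (emb-injective S ea′≡ea) (emb-injective S eb′≡eb) a′b′)
    meets-H-at-ends : All (λ u → InV S u → u ≡ emb S a ⊎ u ≡ emb S b) (emb S a ∷ mid ++ [ emb S b ])
    meets-H-at-ends = (λ _ → inj₁ refl)
                    ∷ All.++⁺ (All.map (λ out in-H → ⊥-elim (out in-H)) outs) ((λ _ → inj₂ refl) ∷ [])

  induced : ∀ {a b} → Adj G (emb S a) (emb S b) → Adj (H S) a b
  induced ab = Adj-of-outside-path (λ { refl → Adj-irrefl G ab refl }) [] [] [] (ab ∷ [-])

  -- a is adjacent to the component of G − V(H) containing v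
  Attached : Fin n → Fin (m S) → Set
  Attached v a = ∃ λ y → Walk v y × Adj G y (emb S a)

  attached? : ∀ v → Decidable (Attached v)
  attached? v a = any? (λ y → walk? v y ×-dec Adj? G y (emb S a))

  attached-clique : ∀ {v a b} → Attached v a → Attached v b → a ≢ b → Adj (H S) a b
  attached-clique (_ , w₁ , y₁a) (_ , w₂ , y₂b) a≢b =
    let w , unique = shorten (reverseʷ w₁ ++ʷ w₂)
    in Adj-of-outside-path a≢b (verts w) (verts-inside w) unique (linked-verts (Adj-sym G y₁a) w y₂b)

  attached-here : ∀ {v a} → Outside S v → Adj G v (emb S a) → Attached v a
  attached-here v-out va = _ , stay v-out , va

  attached-step : ∀ {u v} → Outside S u → Adj G u v → ∀ {a} → Attached v a → Attached u a
  attached-step u-out uv (y , w , ya) = y , step u-out uv w , ya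

  attachments : Fin n → List (Fin (m S))
  attachments v = filter (attached? v) (allFin (m S))

  attachments-edge : ∀ {u v} → Outside S u → Outside S v → Adj G u v → attachments u ≡ attachments v
  attachments-edge {u} {v} u-out v-out uv =
    filter-≐ (attached? u) (attached? v)
      (attached-step v-out (Adj-sym G uv) , attached-step u-out uv) (allFin (m S))

  attachments-injective : ∀ {k} {c : Colouring (m S) k} → Proper (H S) c →
                          ∀ v → InjectiveOn c (attachments v)
  attachments-injective proper v {a} {b} a∈ b∈ ca≡cb with a ≟ b
  ... | yes a≡b = a≡b
  ... | no a≢b  = ⊥-elim (proper a b (attached-clique (attached a∈) (attached b∈) a≢b) ca≡cb)
    where
    attached : ∀ {x} → x ∈ attachments v → Attached v x
    attached = proj₂ ∘ ∈-filter⁻ (attached? v) {xs = allFin (m S)}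

  module Recolour {k} {c c′ : Colouring (m S) k} (c-proper : Proper (H S) c) (c′-proper : Proper (H S) c′) where

    π : Fin n → Permutation′ k
    π v = recolouring c c′ (attachments v)

    π-sends : ∀ {v a} → Outside S v → Adj G v (emb S a) → π v ⟨$⟩ʳ c a ≡ c′ a
    π-sends {v} {a} v-out va = recolouring-sends
      (attachments-injective c-proper v) (attachments-injective c′-proper v)
      (∈-filter⁺ (attached? v) (∈-allFin a) (attached-here v-out va))

    recolour : Colouring n k → Colouring n k
    recolour d x with InV? S x
    ... | yes (a , _) = c′ a
    ... | no _        = π x ⟨$⟩ʳ d x

    recolour-inside : ∀ d a → recolour d (emb S a) ≡ c′ a
    recolour-inside d a with InV? S (emb S a)
    ... | yes (a′ , ea′≡ea) = cong c′ (emb-injective S ea′≡ea)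
    ... | no a-out          = ⊥-elim (a-out (a , refl))

    recolour-outside : ∀ d {x} → Outside S x → recolour d x ≡ π x ⟨$⟩ʳ d x
    recolour-outside d {x} x-out with InV? S x
    ... | yes x-in = ⊥-elim (x-out x-in)
    ... | no _     = refl

    recolour-proper : ∀ {d} → ProperExtension G (emb S) c d → ProperExtension G (emb S) c′ (recolour d)
    recolour-proper {d} (d∘e≗c , d-proper) = recolour-inside d , proper
      where
      across : ∀ {a y} → Outside S y → Adj G (emb S a) y → c′ a ≢ π y ⟨$⟩ʳ d y
      across {a} {y} y-out ay eq = d-proper (emb S a) y ay
        (trans (d∘e≗c a) (⟨$⟩ʳ-injective (π y) (trans (π-sends y-out (Adj-sym G ay)) eq)))
      proper : Proper G (recolour d)
      proper x y xy with InV? S x | InV? S y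
      ... | yes (a , refl) | yes (b , refl) = c′-proper a b (induced xy)
      ... | yes (a , refl) | no y-out       = across y-out xy
      ... | no x-out       | yes (b , refl) = across x-out (Adj-sym G xy) ∘ sym
      ... | no x-out       | no y-out       = λ eq → d-proper x y xy (⟨$⟩ʳ-injective (π x)
        (trans eq (cong (λ as → recolouring c c′ as ⟨$⟩ʳ d y)
                        (attachments-edge y-out x-out (Adj-sym G xy)))))

    recolour-injective : ∀ {d d′} → ProperExtension G (emb S) c d → ProperExtension G (emb S) c d′ →
                         recolour d ≗ recolour d′ → d ≗ d′
    recolour-injective {d} {d′} (d∘e≗c , _) (d′∘e≗c , _) same x with InV? S x
    ... | yes (a , refl) = trans (d∘e≗c a) (sym (d′∘e≗c a))
    ... | no x-out       = ⟨$⟩ʳ-injective (π x)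
      (trans (sym (recolour-outside d x-out)) (trans (same x) (recolour-outside d′ x-out)))

  extensions-≤ : ∀ {k} {c c′ : Colouring (m S) k} → Proper (H S) c → Proper (H S) c′ →
                 extensions G (emb S) c ≤ extensions G (emb S) c′
  extensions-≤ {c = c} {c′} c-proper c′-proper =
    ∑𝟙-≤-injection (properExtension? G (emb S) c) (properExtension? G (emb S) c′) recolour
      (ProperExtension-resp G (emb S) c′)
      recolour-proper recolour-injective
    where open Recolour c-proper c′-proper

  extensions-constant : ∀ {k} {c c′ : Colouring (m S) k} → Proper (H S) c → Proper (H S) c′ →
                        extensions G (emb S) c ≡ extensions G (emb S) c′
  extensions-constant c-proper c′-proper =
    ℕ.≤-antisym (extensions-≤ c-proper c′-proper) (extensions-≤ c′-proper c-proper)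

  extensions-along-iso-constant : ∀ {m′ k} {H′ : Graph m′} (φ : Iso H′ (H S)) {c c′ : Colouring m′ k} →
                                  Proper H′ c → Proper H′ c′ →
                                  extensions G (emb S ∘ to φ) c ≡ extensions G (emb S ∘ to φ) c′
  extensions-along-iso-constant {H′ = H′} φ {c} {c′} c-proper c′-proper = begin
      extensions G (emb S ∘ to φ) c
    ≡⟨ extensions-∘ G (emb S) (to-from φ) (from-to φ) c ⟩
      extensions G (emb S) (c ∘ from φ)
    ≡⟨ extensions-constant (Proper-∘ {H′ = H S} {H′} (Iso-from-homomorphism φ) c-proper)
                           (Proper-∘ {H′ = H S} {H′} (Iso-from-homomorphism φ) c′-proper) ⟩
      extensions G (emb S) (c′ ∘ from φ)
    ≡⟨ extensions-∘ G (emb S) (to-from φ) (from-to φ) c′ ⟨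
      extensions G (emb S ∘ to φ) c′ ∎
    where open ≡-Reasoning

-- Subgraph sums

module SubgraphSum {n₁ n₂ n} {G₁ : Graph n₁} {G₂ : Graph n₂} {S₁ : Subgraph G₁} {S₂ : Subgraph G₂}
                   {φ : Iso (H S₁) (H S₂)} {G : Graph n} (sum : IsSubgraphSum G₁ G₂ S₁ S₂ φ G) where

  open IsSubgraphSum sum

  Compatible : ∀ {k} → Colouring n₁ k → Colouring n₂ k → Set
  Compatible d₁ d₂ = d₁ ∘ emb S₁ ≗ d₂ ∘ emb S₂ ∘ to φ

  compatible? : ∀ {k} (d₁ : Colouring n₁ k) (d₂ : Colouring n₂ k) → Dec (Compatible d₁ d₂)
  compatible? d₁ d₂ = d₁ ∘ emb S₁ ≗? d₂ ∘ emb S₂ ∘ to φ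

  amalgamate : ∀ {k} → Colouring n₁ k → Colouring n₂ k → Colouring n k
  amalgamate d₁ d₂ x = [ (λ (v , _) → d₁ v) , (λ (w , _) → d₂ w) ]′ (covers x)

  module _ {k} {d₁ : Colouring n₁ k} {d₂ : Colouring n₂ k} where

    amalgamate-ι₁ : Compatible d₁ d₂ → amalgamate d₁ d₂ ∘ ι₁ ≗ d₁
    amalgamate-ι₁ compatible v with covers (ι₁ v)
    ... | inj₁ (v′ , ι₁v′≡ι₁v) = cong d₁ (ι₁-injective ι₁v′≡ι₁v)
    ... | inj₂ (w , ι₂w≡ι₁v) with ⇔.to (glue v w) (sym ι₂w≡ι₁v)
    ...   | a , refl , refl = sym (compatible a)

    amalgamate-ι₂ : Compatible d₁ d₂ → amalgamate d₁ d₂ ∘ ι₂ ≗ d₂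
    amalgamate-ι₂ compatible w with covers (ι₂ w)
    ... | inj₂ (w′ , ι₂w′≡ι₂w) = cong d₂ (ι₂-injective ι₂w′≡ι₂w)
    ... | inj₁ (v , ι₁v≡ι₂w) with ⇔.to (glue v w) ι₁v≡ι₂w
    ...   | a , refl , refl = compatible a

    amalgamate-unique : ∀ {d} → d ∘ ι₁ ≗ d₁ → d ∘ ι₂ ≗ d₂ → d ≗ amalgamate d₁ d₂
    amalgamate-unique {d} d∘ι₁≗d₁ d∘ι₂≗d₂ x with covers x
    ... | inj₁ (v , refl) = d∘ι₁≗d₁ v
    ... | inj₂ (w , refl) = d∘ι₂≗d₂ w

    Proper-amalgamate : Compatible d₁ d₂ →
                        Proper G (amalgamate d₁ d₂) ⇔ (Proper G₁ d₁ × Proper G₂ d₂)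
    Proper-amalgamate compatible = mk⇔
      (λ proper →
          Proper-resp G₁ (amalgamate-ι₁ compatible) (Proper-∘ {H′ = G₁} {G} ι₁-homomorphism proper)
        , Proper-resp G₂ (amalgamate-ι₂ compatible) (Proper-∘ {H′ = G₂} {G} ι₂-homomorphism proper))
      (λ (proper₁ , proper₂) x y xy → proper-along (⇔.to (edges x y) xy) proper₁ proper₂)
      where
      ι₁-homomorphism : IsHomomorphism G₁ G ι₁
      ι₁-homomorphism u v uv = ⇔.from (edges (ι₁ u) (ι₁ v)) (inj₁ (u , v , refl , refl , uv))
      ι₂-homomorphism : IsHomomorphism G₂ G ι₂
      ι₂-homomorphism u v uv = ⇔.from (edges (ι₂ u) (ι₂ v)) (inj₂ (u , v , refl , refl , uv))
      proper-along : ∀ {x y} → (∃ λ u → ∃ λ v → ι₁ u ≡ x × ι₁ v ≡ y × Adj G₁ u v) ⊎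
                                (∃ λ u → ∃ λ v → ι₂ u ≡ x × ι₂ v ≡ y × Adj G₂ u v) →
                     Proper G₁ d₁ → Proper G₂ d₂ → amalgamate d₁ d₂ x ≢ amalgamate d₁ d₂ y
      proper-along (inj₁ (u , v , refl , refl , uv)) proper₁ _ eq = proper₁ u v uv
        (trans (sym (amalgamate-ι₁ compatible u)) (trans eq (amalgamate-ι₁ compatible v)))
      proper-along (inj₂ (u , v , refl , refl , uv)) _ proper₂ eq = proper₂ u v uv
        (trans (sym (amalgamate-ι₂ compatible u)) (trans eq (amalgamate-ι₂ compatible v)))

  restrictions-compatible : ∀ {k} (d : Colouring n k) → Compatible (d ∘ ι₁) (d ∘ ι₂)
  restrictions-compatible d a = cong d (⇔.from (glue _ _) (a , refl , refl))

  module _ {k} (d₁ : Colouring n₁ k) (d₂ : Colouring n₂ k) where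

    private
      Cs = colourings n k
      restricts? = λ (d : Colouring n k) → d ∘ ι₂ ≗? d₂ ×-dec d ∘ ι₁ ≗? d₁

      fibre-term : Colouring n k → ℕ
      fibre-term d = 𝟙 (d ∘ ι₂ ≗? d₂) * (𝟙 (d ∘ ι₁ ≗? d₁) * 𝟙 (Proper? G d))

      fibre-term≡ : ∀ d → fibre-term d ≡ 𝟙 (restricts? d) * 𝟙 (Proper? G d)
      fibre-term≡ d =
        trans (sym (ℕ.*-assoc (𝟙 (d ∘ ι₂ ≗? d₂)) (𝟙 (d ∘ ι₁ ≗? d₁)) (𝟙 (Proper? G d))))
        (cong (_* 𝟙 (Proper? G d)) (sym (𝟙-× (d ∘ ι₂ ≗? d₂) (d ∘ ι₁ ≗? d₁))))

    ∑-amalgamations-incompatible : ¬ Compatible d₁ d₂ → ∑ Cs fibre-term ≡ 0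
    ∑-amalgamations-incompatible incompatible = ∑-zero Cs (λ d → trans (fibre-term≡ d)
      (cong (_* 𝟙 (Proper? G d)) (𝟙-no (restricts? d) (λ (d∘ι₂≗d₂ , d∘ι₁≗d₁) →
        incompatible (λ a →
          trans (sym (d∘ι₁≗d₁ _)) (trans (restrictions-compatible d a) (d∘ι₂≗d₂ _)))))))

    ∑-amalgamations-compatible : Compatible d₁ d₂ →
                                 ∑ Cs fibre-term ≡ 𝟙 (Proper? G₁ d₁) * 𝟙 (Proper? G₂ d₂)
    ∑-amalgamations-compatible compatible = begin
        ∑ Cs fibre-term
      ≡⟨ ∑-cong Cs (λ d → trans (fibre-term≡ d) (trans
           (cong (_* 𝟙 (Proper? G d)) (𝟙-⇔ restricts⇔ (restricts? d) (amalgamation ≗? d)))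
           (𝟙-*-cong (amalgamation ≗? d) (λ d*≗d →
             𝟙-⇔ (mk⇔ (Proper-resp G (sym ∘ d*≗d)) (Proper-resp G d*≗d))
                 (Proper? G d) (Proper? G amalgamation))))) ⟩
        ∑ Cs (λ d → 𝟙 (amalgamation ≗? d) * 𝟙 (Proper? G amalgamation))
      ≡⟨ ∑-*ʳ Cs (𝟙 (Proper? G amalgamation)) (λ d → 𝟙 (amalgamation ≗? d)) ⟩
        ∑ Cs (λ d → 𝟙 (amalgamation ≗? d)) * 𝟙 (Proper? G amalgamation)
      ≡⟨ cong (_* 𝟙 (Proper? G amalgamation)) (∑-𝟙≗? amalgamation) ⟩
        1 * 𝟙 (Proper? G amalgamation)
      ≡⟨ ℕ.*-identityˡ _ ⟩
        𝟙 (Proper? G amalgamation)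
      ≡⟨ 𝟙-⇔ (Proper-amalgamate compatible)
             (Proper? G amalgamation) (Proper? G₁ d₁ ×-dec Proper? G₂ d₂) ⟩
        𝟙 (Proper? G₁ d₁ ×-dec Proper? G₂ d₂)
      ≡⟨ 𝟙-× (Proper? G₁ d₁) (Proper? G₂ d₂) ⟩
        𝟙 (Proper? G₁ d₁) * 𝟙 (Proper? G₂ d₂) ∎
      where
      open ≡-Reasoning
      amalgamation = amalgamate d₁ d₂
      restricts⇔ : ∀ {d} → (d ∘ ι₂ ≗ d₂ × d ∘ ι₁ ≗ d₁) ⇔ amalgamation ≗ d
      restricts⇔ {d} = mk⇔
        (λ (d∘ι₂≗d₂ , d∘ι₁≗d₁) x → sym (amalgamate-unique d∘ι₁≗d₁ d∘ι₂≗d₂ x))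
        (λ d*≗d → (λ w → trans (sym (d*≗d (ι₂ w))) (amalgamate-ι₂ compatible w))
                , (λ v → trans (sym (d*≗d (ι₁ v))) (amalgamate-ι₁ compatible v)))

    ∑-amalgamations :
      ∑ Cs fibre-term ≡ 𝟙 (compatible? d₁ d₂) * (𝟙 (Proper? G₁ d₁) * 𝟙 (Proper? G₂ d₂))
    ∑-amalgamations = by-cases (compatible? d₁ d₂)
      where
      by-cases : (compatible? : Dec (Compatible d₁ d₂)) →
                 ∑ Cs fibre-term ≡ 𝟙 compatible? * (𝟙 (Proper? G₁ d₁) * 𝟙 (Proper? G₂ d₂))
      by-cases (yes compatible) = trans (∑-amalgamations-compatible compatible) (sym (ℕ.*-identityˡ _))
      by-cases (no incompatible) = ∑-amalgamations-incompatible incompatible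

  χ-subgraphSum : ∀ k → χ G k ≡ ∑ (colourings (m S₁) k)
                    (λ c → extensions G₁ (emb S₁) c * extensions G₂ (emb S₂ ∘ to φ) c)
  χ-subgraphSum k = begin
      χ G k
    ≡⟨ χ≡∑𝟙Proper G k ⟩
      ∑ Cs (𝟙 ∘ Proper? G)
    ≡⟨ ∑-fibres Cs (_∘ ι₁) _ ⟩
      ∑ C₁ (λ d₁ → ∑ Cs (λ d → 𝟙 (d ∘ ι₁ ≗? d₁) * 𝟙 (Proper? G d)))
    ≡⟨ ∑-cong C₁ (λ d₁ → ∑-fibres Cs (_∘ ι₂) _) ⟩
      ∑ C₁ (λ d₁ → ∑ C₂ (λ d₂ → ∑ Cs (λ d →
        𝟙 (d ∘ ι₂ ≗? d₂) * (𝟙 (d ∘ ι₁ ≗? d₁) * 𝟙 (Proper? G d)))))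
    ≡⟨ ∑-cong C₁ (λ d₁ → ∑-cong C₂ (∑-amalgamations d₁)) ⟩
      ∑ C₁ (λ d₁ → ∑ C₂ (λ d₂ →
        𝟙 (compatible? d₁ d₂) * (𝟙 (Proper? G₁ d₁) * 𝟙 (Proper? G₂ d₂))))
    ≡⟨ ∑-extensions-* G₁ G₂ (emb S₁) (emb S₂ ∘ to φ) k ⟨
      ∑ (colourings (m S₁) k) (λ c → extensions G₁ (emb S₁) c * extensions G₂ (emb S₂ ∘ to φ) c) ∎
    where
    open ≡-Reasoning
    Cs = colourings n k
    C₁ = colourings n₁ k
    C₂ = colourings n₂ k

-- Only H₂ has to be path-intersecting, and H may be empty (then χ(H, k) = 1).
theorem3p5 : ∀ {n₁ n₂ : ℕ} (G₁ : Graph n₁) (G₂ : Graph n₂)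
    (S₁ : Subgraph G₁) (S₂ : Subgraph G₂)
    → 0 < m S₁ → 0 < m S₂
    → PathIntersecting S₁ → PathIntersecting S₂
    → (φ : Iso (H S₁) (H S₂))
    → ∀ {n : ℕ} (G : Graph n) → IsSubgraphSum G₁ G₂ S₁ S₂ φ G
    → ∀ (k : ℕ) → χ G k * χ (H S₁) k ≡ χ G₁ k * χ G₂ k
theorem3p5 G₁ G₂ S₁ S₂ _ _ _ S₂-pi φ G sum k = begin
    χ G k * χ (H S₁) k
  ≡⟨ cong₂ _*_ (SubgraphSum.χ-subgraphSum sum k) (χ≡∑𝟙Proper (H S₁) k) ⟩
    ∑ Cs (λ c → f c * g c) * ∑ Cs (𝟙 ∘ Proper? (H S₁))
  ≡⟨ ∑-*-∑𝟙 (Proper? (H S₁)) Cs f g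
       (extensions-of-improper {H′ = H S₁} G₁ (emb-edge S₁))
       (extensions-of-improper {H′ = H S₁} G₂ (λ a b → emb-edge S₂ _ _ ∘ Iso-to-homomorphism φ a b))
       (Attachments.extensions-along-iso-constant {S = S₂} S₂-pi φ) ⟩
    ∑ Cs f * ∑ Cs g
  ≡⟨ cong₂ _*_ (χ≡∑extensions G₁ (emb S₁) k) (χ≡∑extensions G₂ (emb S₂ ∘ to φ) k) ⟨
    χ G₁ k * χ G₂ k ∎
  where
  open ≡-Reasoning
  Cs = colourings (m S₁) k
  f = extensions G₁ (emb S₁)
  g = extensions G₂ (emb S₂ ∘ to φ)
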